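{- In the construction described in the context, let $N$ be a positive integer and $v\in\{1,\dots,q\}$. Then $B_{N,v}$ has dimension $dv$, and the vectors $(X_N^j)_{1\le j\le d}\cup(V_k^j)_{1\le j\le d,\ N+1\le k\le N+v-1}$ form a $\mathbb{Z}$-basis of $B_{N,v}\cap\mathbb{Z}^n$.
   Context: Fix positive integers $d,q$, $n=(q+1)d$, a real $\alpha>2$ and a prime $\theta\ge5$. For $i\in\{0,\dots,qd-1\}$, $j\in\{1,\dots,d\}$, $(u^{(i,j)}_k)_{k\ge0}$ are integer sequences with $u^{(i,j)}_k\in\{2,3\}$ if $i$ is the remainder of $k+(j-1)q$ modulo $qd$ and $u^{(i,j)}_k=0$ otherwise, chosen so that the numbers $\sigma_{i,j}=\sum_{k\ge0}u^{(i,j)}_k\theta^{ -\lfloor\alpha^k\rfloor}$ are algebraically independent over $\mathbb{Q}$. Let $e_1,\dots,e_n$ be the canonical basis of $\mathbb{R}^n$. Set $\sigma_{i,j,N}=\sum_{k=0}^N u^{(i,j)}_k\theta^{ -\lfloor\alpha^k\rfloor}$ and $X_N^j=\theta^{\lfloor\alpha^N\rfloor}\big(e_j+\sum_{i=0}^{qd-1}\sigma_{i,j,N}e_{d+1+i}\big)\in\mathbb{Z}^n$. Let $U_N^j=\sum_{i=0}^{qd-1}u^{(i,j)}_N e_{d+1+i}$ and $V_N^j=U_N^j/\|U_N^j\|$ (a canonical basis vector). For positive integers $N,v$, $B_{N,v}=\mathrm{Span}(X_{N+k}^j:1\le j\le d,\ 0\le k\le v-1)$. -}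

module Defs where

open import Data.Nat as ℕ using (ℕ; zero; suc; _∸_; _^_; NonZero)
open import Data.Nat.Properties using (m*n≢0)
open import Data.Nat.DivMod using (_%_)
open import Data.Integer as ℤ using (ℤ)
open import Data.Rational as ℚ using (ℚ)
open import Data.Fin as Fin using (Fin; toℕ; splitAt; remQuot)
open import Data.Sum using (_⊎_; inj₁; inj₂)
open import Data.Product using (Σ; _×_; _,_)
open import Relation.Binary.PropositionalEquality using (_≡_; _≢_)
open import Relation.Nullary using (yes; no; ¬_)

ZVec : ℕ → Set
ZVec n = Fin n → ℤ

sumℚ : ∀ {m} → (Fin m → ℚ) → ℚ
sumℚ {zero} f = ℚ.0ℚ
sumℚ {suc m} f = f Fin.zero ℚ.+ sumℚ (λ t → f (Fin.suc t))

sumℤ : ∀ {m} → (Fin m → ℤ) → ℤ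
sumℤ {zero} f = ℤ.0ℤ
sumℤ {suc m} f = f Fin.zero ℤ.+ sumℤ (λ t → f (Fin.suc t))

sumTo : ℕ → (ℕ → ℕ) → ℕ
sumTo zero g = g zero
sumTo (suc N) g = sumTo N g ℕ.+ g (suc N)

linℚ : ∀ {m n} → (Fin m → ℚ) → (Fin m → ZVec n) → Fin n → ℚ
linℚ c f x = sumℚ (λ t → c t ℚ.* (f t x ℚ./ 1))

linℤ : ∀ {m n} → (Fin m → ℤ) → (Fin m → ZVec n) → ZVec n
linℤ c f x = sumℤ (λ t → c t ℤ.* f t x)

-- x lies in the (rational, equivalently real) linear span of the family f
InSpan : ∀ {m n} → (Fin m → ZVec n) → ZVec n → Set
InSpan {m} f y = Σ (Fin m → ℚ) λ c → ∀ x → linℚ c f x ≡ (y x ℚ./ 1)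

InZSpan : ∀ {m n} → (Fin m → ZVec n) → ZVec n → Set
InZSpan {m} f y = Σ (Fin m → ℤ) λ c → ∀ x → linℤ c f x ≡ y x

-- linear independence over ℚ (equivalently over ℝ, the entries being integers)
LinIndep : ∀ {m n} → (Fin m → ZVec n) → Set
LinIndep {m} f = (c : Fin m → ℚ) → (∀ x → linℚ c f x ≡ ℚ.0ℚ) → ∀ t → c t ≡ ℚ.0ℚ

ZLinIndep : ∀ {m n} → (Fin m → ZVec n) → Set
ZLinIndep {m} f = (c : Fin m → ℤ) → (∀ x → linℤ c f x ≡ ℤ.0ℤ) → ∀ t → c t ≡ ℤ.0ℤ

-- the vector space Span(g) has dimension k: it has a basis with k elements
-- (basis vectors taken among integer vectors, which suffices as Span(g) is rational)
HasDim : ∀ {m n} → (Fin m → ZVec n) → ℕ → Set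
HasDim {m} {n} g k =
  Σ (Fin k → ZVec n) λ b →
    (∀ t → InSpan g (b t)) × LinIndep b × (∀ y → InSpan b y → InSpan g y)

IsZBasisOfSpanLattice : ∀ {m k n} → (Fin k → ZVec n) → (Fin m → ZVec n) → Set
IsZBasisOfSpanLattice b g =
  (∀ t → InSpan g (b t)) × ZLinIndep b × (∀ y → InSpan g y → InZSpan b y)

-- Paper indices: j ∈ {1..d} ↦ Fin d (j-1);
-- i ∈ {0..qd-1} ↦ Fin (q*d); coordinate e_j ↦ inject j, e_{d+1+i} ↦ raise d i;
-- n = (q+1)d = suc q * d ≡ d + q * d definitionally.
-- a k plays the role of ⌊α^k⌋.

IsRem : (q d : ℕ) .{{_ : NonZero q}} .{{_ : NonZero d}} → Fin (q ℕ.* d) → Fin d → ℕ → Set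
IsRem q d i j k = toℕ i ≡ ((k ℕ.+ toℕ j ℕ.* q) % (q ℕ.* d)) {{m*n≢0 q d}}

DigitHyp : (q d : ℕ) .{{_ : NonZero q}} .{{_ : NonZero d}} →
           (Fin (q ℕ.* d) → Fin d → ℕ → ℕ) → Set
DigitHyp q d u = ∀ i j k →
  (IsRem q d i j k → (u i j k ≡ 2 ⊎ u i j k ≡ 3)) × (¬ IsRem q d i j k → u i j k ≡ 0)

-- X_N^j = θ^{a N} (e_j + Σ_i σ_{i,j,N} e_{d+1+i}),  with
-- θ^{a N} σ_{i,j,N} = Σ_{k=0}^{N} u^{(i,j)}_k θ^{a N - a k}  (a is increasing)
X : (q d θ : ℕ) (a : ℕ → ℕ) (u : Fin (q ℕ.* d) → Fin d → ℕ → ℕ) →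
    ℕ → Fin d → ZVec (suc q ℕ.* d)
X q d θ a u N j x with splitAt d x
... | inj₁ j′ with j′ Fin.≟ j
...   | yes _ = ℤ.+ (θ ^ a N)
...   | no _ = ℤ.0ℤ
X q d θ a u N j x | inj₂ i = ℤ.+ sumTo N (λ k → u i j k ℕ.* θ ^ (a N ∸ a k))

U : (q d : ℕ) (u : Fin (q ℕ.* d) → Fin d → ℕ → ℕ) → ℕ → Fin d → ZVec (suc q ℕ.* d)
U q d u N j x with splitAt d x
... | inj₁ _ = ℤ.0ℤ
... | inj₂ i = ℤ.+ (u i j N)

-- V_N^j = U_N^j / ‖U_N^j‖ : as U_N^j has exactly one nonzero coordinate (under DigitHyp),
-- this is the canonical basis vector at that coordinate.
V : (q d : ℕ) (u : Fin (q ℕ.* d) → Fin d → ℕ → ℕ) → ℕ → Fin d → ZVec (suc q ℕ.* d)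
V q d u N j x with splitAt d x
... | inj₁ _ = ℤ.0ℤ
... | inj₂ i with u i j N ℕ.≟ 0
...   | yes _ = ℤ.0ℤ
...   | no _ = ℤ.1ℤ

Bgen : (q d θ : ℕ) (a : ℕ → ℕ) (u : Fin (q ℕ.* d) → Fin d → ℕ → ℕ) →
       (N v : ℕ) → Fin (v ℕ.* d) → ZVec (suc q ℕ.* d)
Bgen q d θ a u N v t with remQuot {v} d t
... | (k , j) = X q d θ a u (N ℕ.+ toℕ k) j

Bbasis : (q d θ : ℕ) (a : ℕ → ℕ) (u : Fin (q ℕ.* d) → Fin d → ℕ → ℕ) →
         (N v : ℕ) → Fin (v ℕ.* d) → ZVec (suc q ℕ.* d)
Bbasis q d θ a u N v t with remQuot {v} d t
... | (Fin.zero , j) = X q d θ a u N j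
... | (Fin.suc k , j) = V q d u (N ℕ.+ suc (toℕ k)) j

{-# OPTIONS --safe #-}
module Submission where

-- The recurrence X_{K+1}^j = θ^{a(K+1) ∸ a K} X_K^j + u V_{K+1}^j, with a digit u ∈ {2,3}, shows that
-- B_{N,v} is also spanned by the X_N^j and the V_{N+k}^j (1 ≤ k < v).  V_{N+k}^j is the unit vector
-- at its pivot e_{d+1+i}, i ≡ N + k + (j-1)q (mod qd), and since v ≤ q all these pivots, including
-- those of level k = 0, are distinct.  Let Σ c_j X_N^j + Σ c_{k,j} V_{N+k}^j = y be integral.  At e_j
-- this reads M c_j = y_j with M = θ^{a N}.  At the level-0 pivots every V vanishes, and there the
-- d × d matrix of the X_N^j is diagonal modulo θ with entries 2 or 3; as θ ≥ 5 is prime, M dividing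
-- this matrix applied to (y_j)_j forces M ∣ y_j, i.e. c_j ∈ ℤ.  At the pivot of V_{N+k}^j the
-- combination reads c_{k,j} plus an integer combination of the c_j, so c_{k,j} ∈ ℤ.  For y = 0 the
-- same readings give linear independence.

open import Defs
open import Algebra.Bundles using (Ring)
import Algebra.Properties.Semiring.Sum as SemiringSum
open import Data.Empty using (⊥-elim)
open import Data.Fin as Fin using (Fin; _↑ˡ_; _↑ʳ_)
import Data.Fin.Properties as FinP
open import Data.Integer as ℤ using (ℤ; +_; -[1+_])
open import Data.Integer.Divisibility.Signed as ℤ∣ using (_∣_)
import Data.Integer.Properties as ℤP
open import Data.Nat as ℕ using (ℕ; zero; suc; _*_; _^_; _∸_; _<_; _≤_; NonZero; z≤n; s≤s)
import Data.Nat.Coprimality as Coprime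
import Data.Nat.Divisibility as ℕ∣
open import Data.Nat.DivMod using (_%_)
import Data.Nat.DivMod as DM
open import Data.Nat.Primality using (Prime; euclidsLemma; prime⇒nonZero)
import Data.Nat.Properties as ℕP
open import Algebra.Properties.CommutativeSemigroup ℕP.*-commutativeSemigroup using (x∙yz≈y∙xz)
open import Data.Nat.Solver using () renaming (module +-*-Solver to ℕ-Solver)
open import Data.Product using (Σ; ∃; _×_; _,_; proj₁; proj₂)
open import Data.Rational as ℚ using (ℚ; 0ℚ; 1ℚ)
open import Data.Rational.Literals using (fromℤ)
import Data.Rational.Properties as ℚP
open import Data.Rational.Solver using () renaming (module +-*-Solver to ℚ-Solver)
open import Data.Sum using (_⊎_; inj₁; inj₂)
import Data.Vec.Functional as Vec
open import Function using (_∘_)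
open import Relation.Binary.PropositionalEquality
open import Relation.Nullary using (¬_; yes; no)

private
  variable
    m n k : ℕ

-- Integers inside the rationals, and finite sums

toℚ : ℤ → ℚ
toℚ z = z ℚ./ 1

toℚ≡fromℤ : ∀ z → toℚ z ≡ fromℤ z
toℚ≡fromℤ (+ n)    = ℚP.normalize-coprime (Coprime.sym (Coprime.1-coprimeTo n))
toℚ≡fromℤ -[1+ n ] = cong ℚ.-_ (ℚP.normalize-coprime (Coprime.sym (Coprime.1-coprimeTo (suc n))))

toℚ-injective : ∀ {a b} → toℚ a ≡ toℚ b → a ≡ b
toℚ-injective {a} {b} eq = cong ℚ.↥_ (trans (sym (toℚ≡fromℤ a)) (trans eq (toℚ≡fromℤ b)))

toℚ-+ : ∀ a b → toℚ (a ℤ.+ b) ≡ toℚ a ℚ.+ toℚ b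
toℚ-+ a b rewrite toℚ≡fromℤ a | toℚ≡fromℤ b =
  cong toℚ (sym (cong₂ ℤ._+_ (ℤP.*-identityʳ a) (ℤP.*-identityʳ b)))

toℚ-* : ∀ a b → toℚ (a ℤ.* b) ≡ toℚ a ℚ.* toℚ b
toℚ-* a b rewrite toℚ≡fromℤ a | toℚ≡fromℤ b = refl

toℚ-neg : ∀ a → toℚ (ℤ.- a) ≡ ℚ.- toℚ a
toℚ-neg a rewrite toℚ≡fromℤ a | toℚ≡fromℤ (ℤ.- a) with a
... | + zero     = refl
... | ℤ.+[1+ n ] = refl
... | -[1+ n ]   = refl

toℚ-difference : ∀ {x} a b → toℚ b ℚ.+ x ≡ toℚ a → x ≡ toℚ (a ℤ.- b)
toℚ-difference {x} a b b+x≡a = begin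
  x                          ≡⟨ solve 2 (λ x b → x := (b :+ x) :- b) refl x (toℚ b) ⟩
  (toℚ b ℚ.+ x) ℚ.- toℚ b    ≡⟨ cong (ℚ._- toℚ b) b+x≡a ⟩
  toℚ a ℚ.+ ℚ.- toℚ b        ≡⟨ cong (toℚ a ℚ.+_) (toℚ-neg b) ⟨
  toℚ a ℚ.+ toℚ (ℤ.- b)      ≡⟨ toℚ-+ a (ℤ.- b) ⟨
  toℚ (a ℤ.- b)              ∎
  where
  open ≡-Reasoning
  open ℚ-Solver

toℚ-positive : ∀ n .{{_ : NonZero n}} → ℚ.Positive (toℚ (+ n))
toℚ-positive (suc n) = subst ℚ.Positive (sym (toℚ≡fromℤ (+ suc n))) _

toℚ-*-cancelʳ : ∀ n .{{_ : NonZero n}} {p p′} → p ℚ.* toℚ (+ n) ≡ p′ ℚ.* toℚ (+ n) → p ≡ p′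
toℚ-*-cancelʳ n eq =
  ℚP.≤-antisym (ℚP.*-cancelʳ-≤-pos (toℚ (+ n)) {{toℚ-positive n}} (ℚP.≤-reflexive eq))
               (ℚP.*-cancelʳ-≤-pos (toℚ (+ n)) {{toℚ-positive n}} (ℚP.≤-reflexive (sym eq)))

eliminate-recurrence : ∀ α w T x v → α ℚ.* w ≡ 1ℚ →
                       α ℚ.* (T ℚ.* x ℚ.+ w ℚ.* v) ℚ.+ ℚ.- (α ℚ.* T) ℚ.* x ≡ v
eliminate-recurrence α w T x v αw≡1 = begin
  α ℚ.* (T ℚ.* x ℚ.+ w ℚ.* v) ℚ.+ ℚ.- (α ℚ.* T) ℚ.* x
    ≡⟨ solve 5 (λ α w T x v → α :* (T :* x :+ w :* v) :+ (:- (α :* T)) :* x := (α :* w) :* v)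
               refl α w T x v ⟩
  (α ℚ.* w) ℚ.* v   ≡⟨ cong (ℚ._* v) αw≡1 ⟩
  1ℚ ℚ.* v          ≡⟨ ℚP.*-identityˡ v ⟩
  v                 ∎
  where
  open ≡-Reasoning
  open ℚ-Solver

module ∑ℚ = SemiringSum (Ring.semiring ℚP.+-*-ring)
module ∑ℤ = SemiringSum ℤP.+-*-semiring

sumℚ≡sum : (f : Fin m → ℚ) → sumℚ f ≡ ∑ℚ.sum f
sumℚ≡sum {zero}  f = refl
sumℚ≡sum {suc m} f = cong (f Fin.zero ℚ.+_) (sumℚ≡sum (f ∘ Fin.suc))

sumℤ≡sum : (f : Fin m → ℤ) → sumℤ f ≡ ∑ℤ.sum f
sumℤ≡sum {zero}  f = refl
sumℤ≡sum {suc m} f = cong (ℤ._+_ (f Fin.zero)) (sumℤ≡sum (f ∘ Fin.suc))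

sumℚ-cong : {f g : Fin m → ℚ} → (∀ t → f t ≡ g t) → sumℚ f ≡ sumℚ g
sumℚ-cong {f = f} {g} f≗g rewrite sumℚ≡sum f | sumℚ≡sum g = ∑ℚ.sum-cong-≗ f≗g

sumℚ-+ : (f g : Fin m → ℚ) → sumℚ (λ t → f t ℚ.+ g t) ≡ sumℚ f ℚ.+ sumℚ g
sumℚ-+ f g rewrite sumℚ≡sum f | sumℚ≡sum g | sumℚ≡sum (λ t → f t ℚ.+ g t) = ∑ℚ.∑-distrib-+ f g

sumℚ-*ˡ : (c : ℚ) (f : Fin m → ℚ) → c ℚ.* sumℚ f ≡ sumℚ (λ t → c ℚ.* f t)
sumℚ-*ˡ c f rewrite sumℚ≡sum f | sumℚ≡sum (λ t → c ℚ.* f t) = ∑ℚ.*-distribˡ-sum c f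

sumℚ-*ʳ : (c : ℚ) (f : Fin m → ℚ) → sumℚ f ℚ.* c ≡ sumℚ (λ t → f t ℚ.* c)
sumℚ-*ʳ c f rewrite sumℚ≡sum f | sumℚ≡sum (λ t → f t ℚ.* c) = ∑ℚ.*-distribʳ-sum c f

sumℚ-comm : (f : Fin m → Fin n → ℚ) → sumℚ (λ t → sumℚ (f t)) ≡ sumℚ (λ s → sumℚ (λ t → f t s))
sumℚ-comm f = begin
  sumℚ (λ t → sumℚ (f t))               ≡⟨ sumℚ-cong (λ t → sumℚ≡sum (f t)) ⟩
  sumℚ (λ t → ∑ℚ.sum (f t))             ≡⟨ sumℚ≡sum (λ t → ∑ℚ.sum (f t)) ⟩
  ∑ℚ.sum (λ t → ∑ℚ.sum (f t))           ≡⟨ ∑ℚ.∑-comm f ⟩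
  ∑ℚ.sum (λ s → ∑ℚ.sum (λ t → f t s))   ≡⟨ sumℚ≡sum (λ s → ∑ℚ.sum (λ t → f t s)) ⟨
  sumℚ (λ s → ∑ℚ.sum (λ t → f t s))     ≡⟨ sumℚ-cong (λ s → sumℚ≡sum (λ t → f t s)) ⟨
  sumℚ (λ s → sumℚ (λ t → f t s))       ∎
  where open ≡-Reasoning

sumℚ-zero : (f : Fin m → ℚ) → (∀ t → f t ≡ 0ℚ) → sumℚ f ≡ 0ℚ
sumℚ-zero {m} f f≗0 =
  trans (sumℚ-cong f≗0) (trans (sumℚ≡sum {m} (λ _ → 0ℚ)) (∑ℚ.sum-replicate-zero m))

sumℚ-single : (f : Fin m → ℚ) (t : Fin m) → (∀ s → s ≢ t → f s ≡ 0ℚ) → sumℚ f ≡ f t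
sumℚ-single {suc m} f t others = begin
  sumℚ f                              ≡⟨ sumℚ≡sum f ⟩
  ∑ℚ.sum f                            ≡⟨ ∑ℚ.sum-remove f ⟩
  f t ℚ.+ ∑ℚ.sum (Vec.removeAt f t)   ≡⟨ cong (f t ℚ.+_) (sumℚ≡sum (Vec.removeAt f t)) ⟨
  f t ℚ.+ sumℚ (Vec.removeAt f t)     ≡⟨ cong (f t ℚ.+_) (sumℚ-zero (Vec.removeAt f t) rest≡0) ⟩
  f t ℚ.+ 0ℚ                          ≡⟨ ℚP.+-identityʳ (f t) ⟩
  f t                                 ∎
  where
  open ≡-Reasoning
  rest≡0 : ∀ s → Vec.removeAt f t s ≡ 0ℚ
  rest≡0 s = others _ (FinP.punchInᵢ≢i t s)

sumℚ-++ : (f : Fin (m ℕ.+ n) → ℚ) → sumℚ f ≡ sumℚ (f ∘ (_↑ˡ n)) ℚ.+ sumℚ (f ∘ (m ↑ʳ_))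
sumℚ-++ {zero}      f = sym (ℚP.+-identityˡ (sumℚ f))
sumℚ-++ {suc m} {n} f = trans (cong (f Fin.zero ℚ.+_) (sumℚ-++ {m} {n} (f ∘ Fin.suc)))
  (sym (ℚP.+-assoc (f Fin.zero) (sumℚ (f ∘ Fin.suc ∘ (_↑ˡ n))) (sumℚ (f ∘ (suc m ↑ʳ_)))))

toℚ-sumℤ : (f : Fin m → ℤ) → toℚ (sumℤ f) ≡ sumℚ (toℚ ∘ f)
toℚ-sumℤ {zero}  f = refl
toℚ-sumℤ {suc m} f = trans (toℚ-+ (f Fin.zero) (sumℤ (f ∘ Fin.suc)))
                           (cong (toℚ (f Fin.zero) ℚ.+_) (toℚ-sumℤ (f ∘ Fin.suc)))

∣-sumℤ : ∀ {D} (f : Fin m → ℤ) → (∀ t → D ∣ f t) → D ∣ sumℤ f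
∣-sumℤ {zero}  f D∣f = ℤ∣.divides (+ 0) refl
∣-sumℤ {suc m} f D∣f = ℤ∣.∣m∣n⇒∣m+n (D∣f Fin.zero) (∣-sumℤ (f ∘ Fin.suc) (D∣f ∘ Fin.suc))

∣-sumℤ-single : ∀ {D} (f : Fin m → ℤ) (t : Fin m) → (∀ s → s ≢ t → D ∣ f s) → D ∣ sumℤ f → D ∣ f t
∣-sumℤ-single {suc m} {D} f t others D∣Σ = ℤ∣.∣m+n∣n⇒∣m D∣ft+rest D∣rest
  where
  D∣ft+rest : D ∣ f t ℤ.+ ∑ℤ.sum (Vec.removeAt f t)
  D∣ft+rest = subst (D ∣_) (trans (sumℤ≡sum f) (∑ℤ.sum-remove f)) D∣Σ
  D∣rest : D ∣ ∑ℤ.sum (Vec.removeAt f t)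
  D∣rest = subst (D ∣_) (sumℤ≡sum (Vec.removeAt f t))
             (∣-sumℤ (Vec.removeAt f t) (λ s → others _ (FinP.punchInᵢ≢i t s)))

-- Rational spans of integer vectors

indicator : Fin m → Fin m → ℚ
indicator t s with s Fin.≟ t
... | yes _ = 1ℚ
... | no _  = 0ℚ

module _ (f : Fin m → ZVec n) where

  linℚ-congˡ : ∀ {c c′} x → (∀ t → c t ≡ c′ t) → linℚ c f x ≡ linℚ c′ f x
  linℚ-congˡ x c≗c′ = sumℚ-cong (λ t → cong (ℚ._* toℚ (f t x)) (c≗c′ t))

  linℚ-congʳ : ∀ {g : Fin m → ZVec n} c x → (∀ t → f t x ≡ g t x) → linℚ c f x ≡ linℚ c g x
  linℚ-congʳ c x f≗g = sumℚ-cong (λ t → cong (λ z → c t ℚ.* toℚ z) (f≗g t))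

  linℚ-+ : ∀ c c′ x → linℚ (λ t → c t ℚ.+ c′ t) f x ≡ linℚ c f x ℚ.+ linℚ c′ f x
  linℚ-+ c c′ x = trans (sumℚ-cong (λ t → ℚP.*-distribʳ-+ (toℚ (f t x)) (c t) (c′ t)))
                        (sumℚ-+ (λ t → c t ℚ.* toℚ (f t x)) (λ t → c′ t ℚ.* toℚ (f t x)))

  linℚ-*ˡ : ∀ α c x → α ℚ.* linℚ c f x ≡ linℚ (λ t → α ℚ.* c t) f x
  linℚ-*ˡ α c x = trans (sumℚ-*ˡ α (λ t → c t ℚ.* toℚ (f t x)))
                        (sumℚ-cong (λ t → sym (ℚP.*-assoc α (c t) (toℚ (f t x)))))

  linℚ-single : ∀ c x t → (∀ s → s ≢ t → f s x ≡ + 0) → linℚ c f x ≡ c t ℚ.* toℚ (f t x)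
  linℚ-single c x t others = sumℚ-single (λ s → c s ℚ.* toℚ (f s x)) t
    (λ s s≢t → trans (cong (λ z → c s ℚ.* toℚ z) (others s s≢t)) (ℚP.*-zeroʳ (c s)))

  linℚ-indicator : ∀ t x → linℚ (indicator t) f x ≡ toℚ (f t x)
  linℚ-indicator t x = trans (sumℚ-single (λ s → indicator t s ℚ.* toℚ (f s x)) t others) at-t
    where
    others : ∀ s → s ≢ t → indicator t s ℚ.* toℚ (f s x) ≡ 0ℚ
    others s s≢t with s Fin.≟ t
    ... | yes s≡t = ⊥-elim (s≢t s≡t)
    ... | no _    = ℚP.*-zeroˡ (toℚ (f s x))
    at-t : indicator t t ℚ.* toℚ (f t x) ≡ toℚ (f t x)
    at-t with t Fin.≟ t
    ... | yes _   = ℚP.*-identityˡ (toℚ (f t x))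
    ... | no t≢t  = ⊥-elim (t≢t refl)

  linℚ-zeroˡ : ∀ {c} x → (∀ t → c t ≡ 0ℚ) → linℚ c f x ≡ 0ℚ
  linℚ-zeroˡ {c} x c≗0 = sumℚ-zero (λ t → c t ℚ.* toℚ (f t x))
    (λ t → trans (cong (ℚ._* toℚ (f t x)) (c≗0 t)) (ℚP.*-zeroˡ (toℚ (f t x))))

  linℚ-zeroʳ : ∀ c x → (∀ t → f t x ≡ + 0) → linℚ c f x ≡ 0ℚ
  linℚ-zeroʳ c x f≗0 = sumℚ-zero (λ t → c t ℚ.* toℚ (f t x))
    (λ t → trans (cong (λ z → c t ℚ.* toℚ z) (f≗0 t)) (ℚP.*-zeroʳ (c t)))

  toℚ-linℤ : ∀ z x → toℚ (linℤ z f x) ≡ linℚ (toℚ ∘ z) f x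
  toℚ-linℤ z x = trans (toℚ-sumℤ (λ t → z t ℤ.* f t x)) (sumℚ-cong (λ t → toℚ-* (z t) (f t x)))

linℚ-++ : (c : Fin (m ℕ.+ n) → ℚ) (f : Fin (m ℕ.+ n) → ZVec k) (x : Fin k) →
          linℚ c f x ≡ linℚ (c ∘ (_↑ˡ n)) (f ∘ (_↑ˡ n)) x ℚ.+ linℚ (c ∘ (m ↑ʳ_)) (f ∘ (m ↑ʳ_)) x
linℚ-++ {m} {n} c f x = sumℚ-++ {m} {n} (λ t → c t ℚ.* toℚ (f t x))

InSpan-member : (f : Fin m → ZVec n) (t : Fin m) → InSpan f (f t)
InSpan-member f t = indicator t , linℚ-indicator f t

InSpan-resp : {f : Fin m → ZVec n} {y y′ : ZVec n} → (∀ x → y x ≡ y′ x) → InSpan f y → InSpan f y′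
InSpan-resp y≗y′ (c , fc≡y) = c , λ x → trans (fc≡y x) (cong toℚ (y≗y′ x))

InSpan-lincomb : {g : Fin m → ZVec n} {y z w : ZVec n} → InSpan g y → InSpan g z → (α β : ℚ) →
                 (∀ x → α ℚ.* toℚ (y x) ℚ.+ β ℚ.* toℚ (z x) ≡ toℚ (w x)) → InSpan g w
InSpan-lincomb {g = g} {y} {z} {w} (c , gc≡y) (c′ , gc′≡z) α β αy+βz≡w =
  (λ t → α ℚ.* c t ℚ.+ β ℚ.* c′ t) , λ x → begin
    linℚ (λ t → α ℚ.* c t ℚ.+ β ℚ.* c′ t) g x
      ≡⟨ linℚ-+ g (λ t → α ℚ.* c t) (λ t → β ℚ.* c′ t) x ⟩
    linℚ (λ t → α ℚ.* c t) g x ℚ.+ linℚ (λ t → β ℚ.* c′ t) g x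
      ≡⟨ cong₂ ℚ._+_ (linℚ-*ˡ g α c x) (linℚ-*ˡ g β c′ x) ⟨
    α ℚ.* linℚ c g x ℚ.+ β ℚ.* linℚ c′ g x
      ≡⟨ cong₂ (λ u v → α ℚ.* u ℚ.+ β ℚ.* v) (gc≡y x) (gc′≡z x) ⟩
    α ℚ.* toℚ (y x) ℚ.+ β ℚ.* toℚ (z x)
      ≡⟨ αy+βz≡w x ⟩
    toℚ (w x) ∎
  where open ≡-Reasoning

InSpan-trans : (g : Fin m → ZVec n) (b : Fin k → ZVec n) →
               (∀ t → InSpan g (b t)) → ∀ y → InSpan b y → InSpan g y
InSpan-trans {m = m} {k = k} g b b⊆g y (c , bc≡y) = (λ s → sumℚ (λ t → c t ℚ.* C t s)) , λ x → begin
  sumℚ (λ s → sumℚ (λ t → c t ℚ.* C t s) ℚ.* toℚ (g s x))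
    ≡⟨ sumℚ-cong (λ s → sumℚ-*ʳ (toℚ (g s x)) (λ t → c t ℚ.* C t s)) ⟩
  sumℚ (λ s → sumℚ (λ t → c t ℚ.* C t s ℚ.* toℚ (g s x)))
    ≡⟨ sumℚ-cong (λ s → sumℚ-cong (λ t → ℚP.*-assoc (c t) (C t s) (toℚ (g s x)))) ⟩
  sumℚ (λ s → sumℚ (λ t → c t ℚ.* (C t s ℚ.* toℚ (g s x))))
    ≡⟨ sumℚ-comm (λ s t → c t ℚ.* (C t s ℚ.* toℚ (g s x))) ⟩
  sumℚ (λ t → sumℚ (λ s → c t ℚ.* (C t s ℚ.* toℚ (g s x))))
    ≡⟨ sumℚ-cong (λ t → sumℚ-*ˡ (c t) (λ s → C t s ℚ.* toℚ (g s x))) ⟨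
  sumℚ (λ t → c t ℚ.* linℚ (C t) g x)
    ≡⟨ sumℚ-cong (λ t → cong (c t ℚ.*_) (proj₂ (b⊆g t) x)) ⟩
  linℚ c b x
    ≡⟨ bc≡y x ⟩
  toℚ (y x) ∎
  where
  open ≡-Reasoning
  C : Fin k → Fin m → ℚ
  C t = proj₁ (b⊆g t)

LinIndep⇒ZLinIndep : {f : Fin m → ZVec n} → LinIndep f → ZLinIndep f
LinIndep⇒ZLinIndep {f = f} indep z fz≡0 t =
  toℚ-injective (indep (toℚ ∘ z) (λ x → trans (sym (toℚ-linℤ f z x)) (cong toℚ (fz≡0 x))) t)

InSpan⇒InZSpan : {f : Fin m → ZVec n} {y : ZVec n} ((c , _) : InSpan f y) →
                 (∀ t → Σ ℤ λ z → c t ≡ toℚ z) → InZSpan f y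
InSpan⇒InZSpan {m = m} {f = f} {y} (c , fc≡y) c-integral = z , λ x → toℚ-injective (begin
  toℚ (linℤ z f x)     ≡⟨ toℚ-linℤ f z x ⟩
  linℚ (toℚ ∘ z) f x   ≡⟨ linℚ-congˡ f x (sym ∘ proj₂ ∘ c-integral) ⟩
  linℚ c f x           ≡⟨ fc≡y x ⟩
  toℚ (y x)            ∎)
  where
  open ≡-Reasoning
  z : Fin m → ℤ
  z = proj₁ ∘ c-integral

-- Divisibility and index arithmetic

prime-∣-*⇒∣ˡ : ∀ {p a b} → Prime p → ¬ (+ p ∣ b) → + p ∣ a ℤ.* b → + p ∣ a
prime-∣-*⇒∣ˡ {p} {a} {b} p-prime p∤b p∣ab
  with euclidsLemma ℤ.∣ a ∣ ℤ.∣ b ∣ p-prime (subst (p ℕ∣.∣_) (ℤP.abs-* a b) (ℤ∣.∣⇒∣ᵤ p∣ab))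
... | inj₁ p∣a = ℤ∣.∣ᵤ⇒∣ p∣a
... | inj₂ p∣b = ⊥-elim (p∤b (ℤ∣.∣ᵤ⇒∣ p∣b))

module _ {p d : ℕ} (p-prime : Prime p) (A : Fin d → Fin d → ℤ)
         (diagonal : ∀ j → ¬ (+ p ∣ A j j)) (off-diagonal : ∀ j j′ → j′ ≢ j → + p ∣ A j j′) where

  private
    p^E⁺≡p*p^E : ∀ E → + (p ^ suc E) ≡ + p ℤ.* + (p ^ E)
    p^E⁺≡p*p^E E = ℤP.pos-* p (p ^ E)

    p^E⁺≡p^E*p : ∀ E → + (p ^ suc E) ≡ + (p ^ E) ℤ.* + p
    p^E⁺≡p^E*p E = trans (p^E⁺≡p*p^E E) (ℤP.*-comm (+ p) (+ (p ^ E)))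

    p^E∣m⇒p^E⁺∣Am⇒p^E⁺∣m : ∀ E (m : Fin d → ℤ) → (∀ j′ → + (p ^ E) ∣ m j′) →
                           ∀ j → + (p ^ suc E) ∣ sumℤ (λ j′ → m j′ ℤ.* A j j′) → + (p ^ suc E) ∣ m j
    p^E∣m⇒p^E⁺∣Am⇒p^E⁺∣m E m p^E∣m j p^E⁺∣Am =
      subst₂ _∣_ (sym (p^E⁺≡p*p^E E)) (sym (m≡rP j)) (ℤ∣.*-monoˡ-∣ P p∣r)
      where
      P : ℤ
      P = + (p ^ E)
      r : Fin d → ℤ
      r j′ = ℤ∣._∣_.quotient (p^E∣m j′)
      m≡rP : ∀ j′ → m j′ ≡ r j′ ℤ.* P
      m≡rP j′ = ℤ∣._∣_.equality (p^E∣m j′)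
      others : ∀ j′ → j′ ≢ j → + (p ^ suc E) ∣ m j′ ℤ.* A j j′
      others j′ j′≢j = subst (_∣ m j′ ℤ.* A j j′) (sym (p^E⁺≡p^E*p E))
        (ℤ∣.∣-trans (ℤ∣.*-monoʳ-∣ P (off-diagonal j j′ j′≢j)) (ℤ∣.*-monoˡ-∣ (A j j′) (p^E∣m j′)))
      mA≡P*rA : m j ℤ.* A j j ≡ P ℤ.* (r j ℤ.* A j j)
      mA≡P*rA = trans (cong (ℤ._* A j j) (trans (m≡rP j) (ℤP.*-comm (r j) P))) (ℤP.*-assoc P (r j) (A j j))
      P*p∣P*rA : P ℤ.* + p ∣ P ℤ.* (r j ℤ.* A j j)
      P*p∣P*rA = subst₂ _∣_ (p^E⁺≡p^E*p E) mA≡P*rA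
                   (∣-sumℤ-single (λ j′ → m j′ ℤ.* A j j′) j others p^E⁺∣Am)
      p∣r : + p ∣ r j
      p∣r = prime-∣-*⇒∣ˡ p-prime (diagonal j)
              (ℤ∣.*-cancelˡ-∣ P {{ℕP.m^n≢0 p E {{prime⇒nonZero p-prime}}}} P*p∣P*rA)

  p^E∣Am⇒p^E∣m : ∀ E (m : Fin d → ℤ) →
                 (∀ j → + (p ^ E) ∣ sumℤ (λ j′ → m j′ ℤ.* A j j′)) → ∀ j → + (p ^ E) ∣ m j
  p^E∣Am⇒p^E∣m zero    m _        j = ℤ∣.divides (m j) (sym (ℤP.*-identityʳ (m j)))
  p^E∣Am⇒p^E∣m (suc E) m p^E⁺∣Am j = p^E∣m⇒p^E⁺∣Am⇒p^E⁺∣m E m p^E∣m j (p^E⁺∣Am j)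
    where
    p^E∣p^E⁺ : + (p ^ E) ∣ + (p ^ suc E)
    p^E∣p^E⁺ = ℤ∣.divides (+ p) (p^E⁺≡p*p^E E)
    p^E∣m : ∀ j′ → + (p ^ E) ∣ m j′
    p^E∣m = p^E∣Am⇒p^E∣m E m (λ j′ → ℤ∣.∣-trans p^E∣p^E⁺ (p^E⁺∣Am j′))

[m+i]%n≡[m+j]%n⇒i≡j : ∀ n .{{_ : NonZero n}} M {i j} → i < n → j < n →
                      (M ℕ.+ i) % n ≡ (M ℕ.+ j) % n → i ≡ j
[m+i]%n≡[m+j]%n⇒i≡j n@(suc n-1) M {i} {j} i<n j<n eq = begin
  i                                       ≡⟨ remove-M i<n ⟨
  ((M ℕ.+ i) % n ℕ.+ (n-1 * M) % n) % n   ≡⟨ cong (λ r → (r ℕ.+ (n-1 * M) % n) % n) eq ⟩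
  ((M ℕ.+ j) % n ℕ.+ (n-1 * M) % n) % n   ≡⟨ remove-M j<n ⟩
  j                                       ∎
  where
  open ≡-Reasoning
  remove-M : ∀ {s} → s < n → ((M ℕ.+ s) % n ℕ.+ (n-1 * M) % n) % n ≡ s
  remove-M {s} s<n = begin
    ((M ℕ.+ s) % n ℕ.+ (n-1 * M) % n) % n  ≡⟨ DM.%-distribˡ-+ (M ℕ.+ s) (n-1 * M) n ⟨
    (M ℕ.+ s ℕ.+ n-1 * M) % n              ≡⟨ cong (_% n) (solve 3 (λ M s n-1 →
                                                M :+ s :+ n-1 :* M := s :+ M :* (con 1 :+ n-1)) refl M s n-1) ⟩
    (s ℕ.+ M * n) % n                      ≡⟨ DM.[m+kn]%n≡m%n s M n ⟩
    s % n                                  ≡⟨ DM.m<n⇒m%n≡m s<n ⟩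
    s                                      ∎
    where open ℕ-Solver

k+j*q-injective : ∀ {q d k k′} (j j′ : Fin d) → k < q → k′ < q →
                  k ℕ.+ Fin.toℕ j * q ≡ k′ ℕ.+ Fin.toℕ j′ * q → k ≡ k′ × j ≡ j′
k+j*q-injective {q@(suc _)} {k = k} {k′} j j′ k<q k′<q eq =
  k≡k′ , FinP.toℕ-injective (ℕP.*-cancelʳ-≡ (Fin.toℕ j) (Fin.toℕ j′) q jq≡j′q)
  where
  k≡k′ : k ≡ k′
  k≡k′ = begin
    k                            ≡⟨ DM.m<n⇒m%n≡m k<q ⟨
    k % q                        ≡⟨ DM.[m+kn]%n≡m%n k (Fin.toℕ j) q ⟨
    (k ℕ.+ Fin.toℕ j * q) % q    ≡⟨ cong (_% q) eq ⟩
    (k′ ℕ.+ Fin.toℕ j′ * q) % q  ≡⟨ DM.[m+kn]%n≡m%n k′ (Fin.toℕ j′) q ⟩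
    k′ % q                       ≡⟨ DM.m<n⇒m%n≡m k′<q ⟩
    k′                           ∎
    where open ≡-Reasoning
  jq≡j′q : Fin.toℕ j * q ≡ Fin.toℕ j′ * q
  jq≡j′q = ℕP.+-cancelˡ-≡ k _ _ (trans eq (cong (ℕ._+ Fin.toℕ j′ * q) (sym k≡k′)))

k+j*q<q*d : ∀ {q d k} (j : Fin d) → k < q → k ℕ.+ Fin.toℕ j * q < q * d
k+j*q<q*d {q} {d} {k} j k<q = begin-strict
  k ℕ.+ Fin.toℕ j * q   <⟨ ℕP.+-monoˡ-< (Fin.toℕ j * q) k<q ⟩
  suc (Fin.toℕ j) * q   ≤⟨ ℕP.*-monoˡ-≤ q (FinP.toℕ<n j) ⟩
  d * q                 ≡⟨ ℕP.*-comm d q ⟩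
  q * d                 ∎
  where open ℕP.≤-Reasoning

↑-elim : {P : Fin (m ℕ.+ n) → Set} → (∀ i → P (i ↑ˡ n)) → (∀ j → P (m ↑ʳ j)) → ∀ t → P t
↑-elim {m} {P = P} Pˡ Pʳ t with Fin.splitAt m t in eq
... | inj₁ i = subst P (FinP.splitAt⁻¹-↑ˡ eq) (Pˡ i)
... | inj₂ j = subst P (FinP.splitAt⁻¹-↑ʳ eq) (Pʳ j)

sumTo-cong : ∀ K {f g : ℕ → ℕ} → (∀ k → k ≤ K → f k ≡ g k) → sumTo K f ≡ sumTo K g
sumTo-cong zero    f≗g = f≗g 0 z≤n
sumTo-cong (suc K) f≗g =
  cong₂ ℕ._+_ (sumTo-cong K (λ k k≤K → f≗g k (ℕP.m≤n⇒m≤1+n k≤K))) (f≗g (suc K) ℕP.≤-refl)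

sumTo-*ˡ : ∀ K c f → c * sumTo K f ≡ sumTo K (λ k → c * f k)
sumTo-*ˡ zero    c f = refl
sumTo-*ˡ (suc K) c f =
  trans (ℕP.*-distribˡ-+ c (sumTo K f) (f (suc K))) (cong (ℕ._+ c * f (suc K)) (sumTo-*ˡ K c f))

-- The vectors X, U, V

module Construction (d q : ℕ) .{{_ : NonZero d}} .{{_ : NonZero q}} (θ : ℕ)
                    (a : ℕ → ℕ) (a-increasing : ∀ k → a k < a (suc k))
                    (u : Fin (q * d) → Fin d → ℕ → ℕ) (digits : DigitHyp q d u) where

  X′ U′ V′ : ℕ → Fin d → ZVec (suc q * d)
  X′ = X q d θ a u
  U′ = U q d u
  V′ = V q d u

  coordˡ : Fin d → Fin (suc q * d)
  coordˡ j = j ↑ˡ (q * d)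

  coordʳ : Fin (q * d) → Fin (suc q * d)
  coordʳ i = d ↑ʳ i

  θᵃσ : Fin (q * d) → Fin d → ℕ → ℕ
  θᵃσ i j K = sumTo K (λ k → u i j k * θ ^ (a K ∸ a k))

  X-coordˡ-≡ : ∀ K j → X′ K j (coordˡ j) ≡ + (θ ^ a K)
  X-coordˡ-≡ K j rewrite FinP.splitAt-↑ˡ d j (q * d) with j Fin.≟ j
  ... | yes _   = refl
  ... | no j≢j  = ⊥-elim (j≢j refl)

  X-coordˡ-≢ : ∀ K {j j′} → j′ ≢ j → X′ K j (coordˡ j′) ≡ + 0
  X-coordˡ-≢ K {j} {j′} j′≢j rewrite FinP.splitAt-↑ˡ d j′ (q * d) with j′ Fin.≟ j
  ... | yes j′≡j = ⊥-elim (j′≢j j′≡j)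
  ... | no _     = refl

  X-coordʳ : ∀ K j i → X′ K j (coordʳ i) ≡ + θᵃσ i j K
  X-coordʳ K j i rewrite FinP.splitAt-↑ʳ d (q * d) i = refl

  U-coordˡ : ∀ K j j′ → U′ K j (coordˡ j′) ≡ + 0
  U-coordˡ K j j′ rewrite FinP.splitAt-↑ˡ d j′ (q * d) = refl

  U-coordʳ : ∀ K j i → U′ K j (coordʳ i) ≡ + u i j K
  U-coordʳ K j i rewrite FinP.splitAt-↑ʳ d (q * d) i = refl

  V-coordˡ : ∀ K j j′ → V′ K j (coordˡ j′) ≡ + 0
  V-coordˡ K j j′ rewrite FinP.splitAt-↑ˡ d j′ (q * d) = refl

  V-coordʳ-zero : ∀ K j i → u i j K ≡ 0 → V′ K j (coordʳ i) ≡ + 0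
  V-coordʳ-zero K j i u≡0 rewrite FinP.splitAt-↑ʳ d (q * d) i with u i j K ℕ.≟ 0
  ... | yes _   = refl
  ... | no u≢0  = ⊥-elim (u≢0 u≡0)

  V-coordʳ-nonzero : ∀ K j i → u i j K ≢ 0 → V′ K j (coordʳ i) ≡ + 1
  V-coordʳ-nonzero K j i u≢0 rewrite FinP.splitAt-↑ʳ d (q * d) i with u i j K ℕ.≟ 0
  ... | yes u≡0 = ⊥-elim (u≢0 u≡0)
  ... | no _    = refl

  Δa : ℕ → ℕ
  Δa K = a (suc K) ∸ a K

  a-mono : ∀ {k K} → k ≤ K → a k ≤ a K
  a-mono {k} {K} k≤K with ℕP.m≤n⇒m<n∨m≡n k≤K
  ... | inj₂ refl = ℕP.≤-refl
  a-mono {k} {suc K} k≤K | inj₁ (s≤s k≤K′) = ℕP.≤-trans (a-mono k≤K′) (ℕP.<⇒≤ (a-increasing K))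

  θ^a-suc : ∀ K k → k ≤ K → θ ^ (a (suc K) ∸ a k) ≡ θ ^ Δa K * θ ^ (a K ∸ a k)
  θ^a-suc K k k≤K = begin
    θ ^ (a (suc K) ∸ a k)       ≡⟨ cong (λ e → θ ^ (e ∸ a k)) (ℕP.m∸n+n≡m (ℕP.<⇒≤ (a-increasing K))) ⟨
    θ ^ (Δa K ℕ.+ a K ∸ a k)    ≡⟨ cong (θ ^_) (ℕP.+-∸-assoc (Δa K) (a-mono k≤K)) ⟩
    θ ^ (Δa K ℕ.+ (a K ∸ a k))  ≡⟨ ℕP.^-distribˡ-+-* θ (Δa K) (a K ∸ a k) ⟩
    θ ^ Δa K * θ ^ (a K ∸ a k)  ∎
    where open ≡-Reasoning

  θᵃσ-suc : ∀ i j K → θᵃσ i j (suc K) ≡ θ ^ Δa K * θᵃσ i j K ℕ.+ u i j (suc K)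
  θᵃσ-suc i j K = cong₂ ℕ._+_
    (trans (sumTo-cong K shift) (sym (sumTo-*ˡ K (θ ^ Δa K) (λ k → u i j k * θ ^ (a K ∸ a k))))) last
    where
    shift : ∀ k → k ≤ K → u i j k * θ ^ (a (suc K) ∸ a k) ≡ θ ^ Δa K * (u i j k * θ ^ (a K ∸ a k))
    shift k k≤K =
      trans (cong (u i j k *_) (θ^a-suc K k k≤K)) (x∙yz≈y∙xz (u i j k) (θ ^ Δa K) (θ ^ (a K ∸ a k)))
    last : u i j (suc K) * θ ^ (a (suc K) ∸ a (suc K)) ≡ u i j (suc K)
    last = trans (cong (λ e → u i j (suc K) * θ ^ e) (ℕP.n∸n≡0 (a (suc K)))) (ℕP.*-identityʳ (u i j (suc K)))

  θᵃσ≡θ*W+u : ∀ i j K → ∃ λ W → θᵃσ i j K ≡ θ * W ℕ.+ u i j K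
  θᵃσ≡θ*W+u i j zero = 0 , trans (cong (λ e → u i j 0 * θ ^ e) (ℕP.n∸n≡0 (a 0)))
    (trans (ℕP.*-identityʳ (u i j 0)) (cong (ℕ._+ u i j 0) (sym (ℕP.*-zeroʳ θ))))
  θᵃσ≡θ*W+u i j (suc K) = θ ^ ℕ.pred (Δa K) * θᵃσ i j K , (begin
    θᵃσ i j (suc K)                                        ≡⟨ θᵃσ-suc i j K ⟩
    θ ^ Δa K * θᵃσ i j K ℕ.+ u i j (suc K)
      ≡⟨ cong (λ e → e * θᵃσ i j K ℕ.+ u i j (suc K)) (θ^pos (ℕP.m<n⇒0<n∸m (a-increasing K))) ⟩
    θ * θ ^ ℕ.pred (Δa K) * θᵃσ i j K ℕ.+ u i j (suc K)    ≡⟨ cong (ℕ._+ u i j (suc K)) (ℕP.*-assoc θ _ _) ⟩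
    θ * (θ ^ ℕ.pred (Δa K) * θᵃσ i j K) ℕ.+ u i j (suc K)  ∎)
    where
    open ≡-Reasoning
    θ^pos : ∀ {e} → 0 < e → θ ^ e ≡ θ * θ ^ ℕ.pred e
    θ^pos {suc e} _ = refl

  θ∣θᵃσ : ∀ i j K → u i j K ≡ 0 → θ ℕ∣.∣ θᵃσ i j K
  θ∣θᵃσ i j K u≡0 with θᵃσ≡θ*W+u i j K
  ... | W , θᵃσ≡ = subst (θ ℕ∣.∣_) (sym (trans θᵃσ≡ (trans (cong (θ * W ℕ.+_) u≡0) (ℕP.+-identityʳ (θ * W)))))
                         (ℕ∣.m∣m*n W)

  θ∣θᵃσ⇒θ∣u : ∀ i j K → θ ℕ∣.∣ θᵃσ i j K → θ ℕ∣.∣ u i j K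
  θ∣θᵃσ⇒θ∣u i j K θ∣θᵃσ with θᵃσ≡θ*W+u i j K
  ... | W , θᵃσ≡ = ℕ∣.∣m+n∣m⇒∣n (subst (θ ℕ∣.∣_) θᵃσ≡ θ∣θᵃσ) (ℕ∣.m∣m*n W)

  X-suc : ∀ K j x → X′ (suc K) j x ≡ + (θ ^ Δa K) ℤ.* X′ K j x ℤ.+ U′ (suc K) j x
  X-suc K j = ↑-elim left right
    where
    left : ∀ j′ → X′ (suc K) j (coordˡ j′) ≡ + (θ ^ Δa K) ℤ.* X′ K j (coordˡ j′) ℤ.+ U′ (suc K) j (coordˡ j′)
    left j′ rewrite U-coordˡ (suc K) j j′ | ℤP.+-identityʳ (+ (θ ^ Δa K) ℤ.* X′ K j (coordˡ j′))
      with j′ Fin.≟ j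
    ... | yes refl rewrite X-coordˡ-≡ (suc K) j | X-coordˡ-≡ K j =
      trans (cong +_ θ^a≡) (ℤP.pos-* (θ ^ Δa K) (θ ^ a K))
      where
      θ^a≡ : θ ^ a (suc K) ≡ θ ^ Δa K * θ ^ a K
      θ^a≡ = trans (cong (θ ^_) (sym (ℕP.m∸n+n≡m (ℕP.<⇒≤ (a-increasing K))))) (ℕP.^-distribˡ-+-* θ (Δa K) (a K))
    ... | no j′≢j rewrite X-coordˡ-≢ (suc K) j′≢j | X-coordˡ-≢ K j′≢j = sym (ℤP.*-zeroʳ (+ (θ ^ Δa K)))
    right : ∀ i → X′ (suc K) j (coordʳ i) ≡ + (θ ^ Δa K) ℤ.* X′ K j (coordʳ i) ℤ.+ U′ (suc K) j (coordʳ i)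
    right i rewrite X-coordʳ (suc K) j i | X-coordʳ K j i | U-coordʳ (suc K) j i | θᵃσ-suc i j K =
      trans (ℤP.pos-+ (θ ^ Δa K * θᵃσ i j K) (u i j (suc K)))
            (cong (ℤ._+ + u i j (suc K)) (ℤP.pos-* (θ ^ Δa K) (θᵃσ i j K)))

  instance
    qd≢0 : NonZero (q * d)
    qd≢0 = ℕP.m*n≢0 q d

  -- the only i for which u^{(i,j)}_K may be nonzero, i.e. the support of V_K^j
  pivot : ℕ → Fin d → Fin (q * d)
  pivot K j = Fin.fromℕ< (DM.m%n<n (K ℕ.+ Fin.toℕ j * q) (q * d))

  IsRem-pivot : ∀ K j → IsRem q d (pivot K j) j K
  IsRem-pivot K j = FinP.toℕ-fromℕ< (DM.m%n<n (K ℕ.+ Fin.toℕ j * q) (q * d))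

  IsRem⇒pivot : ∀ {i j K} → IsRem q d i j K → i ≡ pivot K j
  IsRem⇒pivot {i} {j} {K} isRem = FinP.toℕ-injective (trans isRem (sym (IsRem-pivot K j)))

  u-off-pivot : ∀ {i j K} → i ≢ pivot K j → u i j K ≡ 0
  u-off-pivot {i} {j} {K} i≢pivot = proj₂ (digits i j K) (i≢pivot ∘ IsRem⇒pivot {i} {j} {K})

  digit : ℕ → Fin d → ℕ
  digit K j = u (pivot K j) j K

  digit-2⊎3 : ∀ K j → digit K j ≡ 2 ⊎ digit K j ≡ 3
  digit-2⊎3 K j = proj₁ (digits (pivot K j) j K) (IsRem-pivot K j)

  digit-bounds : ∀ K j → 0 < digit K j × digit K j < 5
  digit-bounds K j with digit-2⊎3 K j
  ... | inj₁ digit≡2 rewrite digit≡2 = ℕ.z<s , ℕ.s<s (ℕ.s<s ℕ.z<s)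
  ... | inj₂ digit≡3 rewrite digit≡3 = ℕ.z<s , ℕ.s<s (ℕ.s<s (ℕ.s<s ℕ.z<s))

  instance
    digit-nonZero : ∀ {K j} → NonZero (digit K j)
    digit-nonZero {K} {j} = ℕ.>-nonZero (proj₁ (digit-bounds K j))

  θ∤digit : 5 ≤ θ → ∀ K j → ¬ (θ ℕ∣.∣ digit K j)
  θ∤digit θ≥5 K j = ℕ∣.>⇒∤ (ℕP.<-≤-trans (proj₂ (digit-bounds K j)) θ≥5)

  V-pivot : ∀ K j → V′ K j (coordʳ (pivot K j)) ≡ + 1
  V-pivot K j = V-coordʳ-nonzero K j (pivot K j) (ℕ.≢-nonZero⁻¹ (digit K j))

  V-off-pivot : ∀ K j {i} → i ≢ pivot K j → V′ K j (coordʳ i) ≡ + 0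
  V-off-pivot K j {i} i≢pivot = V-coordʳ-zero K j i (u-off-pivot i≢pivot)

  U≡digit*V : ∀ K j x → U′ K j x ≡ + digit K j ℤ.* V′ K j x
  U≡digit*V K j = ↑-elim left right
    where
    left : ∀ j′ → U′ K j (coordˡ j′) ≡ + digit K j ℤ.* V′ K j (coordˡ j′)
    left j′ rewrite U-coordˡ K j j′ | V-coordˡ K j j′ = sym (ℤP.*-zeroʳ (+ digit K j))
    right : ∀ i → U′ K j (coordʳ i) ≡ + digit K j ℤ.* V′ K j (coordʳ i)
    right i with i Fin.≟ pivot K j
    ... | yes refl rewrite U-coordʳ K j (pivot K j) | V-pivot K j = sym (ℤP.*-identityʳ (+ digit K j))
    ... | no i≢pivot rewrite U-coordʳ K j i | V-off-pivot K j i≢pivot | u-off-pivot {i} {j} {K} i≢pivot =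
      sym (ℤP.*-zeroʳ (+ digit K j))

  X-suc-V : ∀ K j x → X′ (suc K) j x ≡ + (θ ^ Δa K) ℤ.* X′ K j x ℤ.+ + digit (suc K) j ℤ.* V′ (suc K) j x
  X-suc-V K j x = trans (X-suc K j x) (cong (ℤ._+_ (+ (θ ^ Δa K) ℤ.* X′ K j x)) (U≡digit*V (suc K) j x))

  pivot-injective : ∀ K {k k′ j j′} → k < q → k′ < q →
                    pivot (K ℕ.+ k) j ≡ pivot (K ℕ.+ k′) j′ → k ≡ k′ × j ≡ j′
  pivot-injective K {k} {k′} {j} {j′} k<q k′<q eq = k+j*q-injective j j′ k<q k′<q
    ([m+i]%n≡[m+j]%n⇒i≡j (q * d) K (k+j*q<q*d j k<q) (k+j*q<q*d j′ k′<q) (begin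
      (K ℕ.+ (k ℕ.+ Fin.toℕ j * q)) % (q * d)     ≡⟨ cong (_% (q * d)) (ℕP.+-assoc K k _) ⟨
      (K ℕ.+ k ℕ.+ Fin.toℕ j * q) % (q * d)       ≡⟨ IsRem-pivot (K ℕ.+ k) j ⟨
      Fin.toℕ (pivot (K ℕ.+ k) j)                 ≡⟨ cong Fin.toℕ eq ⟩
      Fin.toℕ (pivot (K ℕ.+ k′) j′)               ≡⟨ IsRem-pivot (K ℕ.+ k′) j′ ⟩
      (K ℕ.+ k′ ℕ.+ Fin.toℕ j′ * q) % (q * d)     ≡⟨ cong (_% (q * d)) (ℕP.+-assoc K k′ _) ⟩
      (K ℕ.+ (k′ ℕ.+ Fin.toℕ j′ * q)) % (q * d)   ∎))
    where open ≡-Reasoning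

  pivot-injectiveʳ : ∀ K {j j′} → pivot K j ≡ pivot K j′ → j ≡ j′
  pivot-injectiveʳ K {j} {j′} eq =
    proj₂ (pivot-injective K 0<q 0<q (subst (λ K′ → pivot K′ j ≡ pivot K′ j′) (sym (ℕP.+-identityʳ K)) eq))
    where
    0<q : 0 < q
    0<q = ℕ.>-nonZero⁻¹ q

-- The family B_{N,v} and its candidate basis

-- With v = suc v′, an index of Bbasis in Fin (suc v′ * d) = Fin (d + v′ * d) is either j ↑ˡ _,
-- standing for X_N^j, or d ↑ʳ t, standing for V_{N+1+k}^j where (k , j) = remQuot t.
module Block (d q : ℕ) .{{_ : NonZero d}} .{{_ : NonZero q}} (θ : ℕ) (θ-prime : Prime θ) (θ≥5 : 5 ≤ θ)
             (a : ℕ → ℕ) (a-increasing : ∀ k → a k < a (suc k))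
             (u : Fin (q * d) → Fin d → ℕ → ℕ) (digits : DigitHyp q d u)
             (N v′ : ℕ) (v≤q : suc v′ ≤ q) where

  open Construction d q θ a a-increasing u digits

  G B : Fin (suc v′ * d) → ZVec (suc q * d)
  G = Bgen q d θ a u N (suc v′)
  B = Bbasis q d θ a u N (suc v′)

  level : Fin (v′ * d) → ℕ
  level t = suc (Fin.toℕ (Fin.quotient {v′} d t))

  column : Fin (v′ * d) → Fin d
  column t = Fin.remainder {v′} d t

  level<q : ∀ t → level t < q
  level<q t = ℕP.<-≤-trans (s≤s (FinP.toℕ<n (Fin.quotient {v′} d t))) v≤q

  column-level-injective : ∀ {s t} → level s ≡ level t → column s ≡ column t → s ≡ t
  column-level-injective {s} {t} level≡ column≡ = begin
    s                                                ≡⟨ FinP.combine-remQuot {v′} d s ⟨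
    Fin.combine (Fin.quotient {v′} d s) (column s)   ≡⟨ cong₂ Fin.combine quotient≡ column≡ ⟩
    Fin.combine (Fin.quotient {v′} d t) (column t)   ≡⟨ FinP.combine-remQuot {v′} d t ⟩
    t                                                ∎
    where
    open ≡-Reasoning
    quotient≡ : Fin.quotient {v′} d s ≡ Fin.quotient {v′} d t
    quotient≡ = FinP.toℕ-injective (ℕP.suc-injective level≡)

  Xblock : Fin d → ZVec (suc q * d)
  Xblock = X′ N

  Vblock : Fin (v′ * d) → ZVec (suc q * d)
  Vblock t = V′ (N ℕ.+ level t) (column t)

  lowerCoeffs : (Fin (suc v′ * d) → ℚ) → Fin d → ℚ
  lowerCoeffs c = c ∘ (_↑ˡ (v′ * d))

  upperCoeffs : (Fin (suc v′ * d) → ℚ) → Fin (v′ * d) → ℚ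
  upperCoeffs c = c ∘ (d ↑ʳ_)

  lowerRow : Fin d → Fin (suc q * d)
  lowerRow j = coordʳ (pivot N j)

  upperRow : Fin (v′ * d) → Fin (suc q * d)
  upperRow t = coordʳ (pivot (N ℕ.+ level t) (column t))

  B-↑ˡ : ∀ j x → B (j ↑ˡ (v′ * d)) x ≡ Xblock j x
  B-↑ˡ j x rewrite FinP.splitAt-↑ˡ d j (v′ * d) = refl

  B-↑ʳ : ∀ t x → B (d ↑ʳ t) x ≡ Vblock t x
  B-↑ʳ t x rewrite FinP.splitAt-↑ʳ d (v′ * d) t = refl

  X-step-ℚ : ∀ k j x → toℚ (X′ (N ℕ.+ suc k) j x) ≡
             toℚ (+ (θ ^ Δa (N ℕ.+ k))) ℚ.* toℚ (X′ (N ℕ.+ k) j x)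
             ℚ.+ toℚ (+ digit (N ℕ.+ suc k) j) ℚ.* toℚ (V′ (N ℕ.+ suc k) j x)
  X-step-ℚ k j x rewrite ℕP.+-suc N k = begin
    toℚ (X′ (suc K) j x)                                      ≡⟨ cong toℚ (X-suc-V K j x) ⟩
    toℚ (T ℤ.* X′ K j x ℤ.+ W ℤ.* V′ (suc K) j x)             ≡⟨ toℚ-+ (T ℤ.* X′ K j x) (W ℤ.* V′ (suc K) j x) ⟩
    toℚ (T ℤ.* X′ K j x) ℚ.+ toℚ (W ℤ.* V′ (suc K) j x)
      ≡⟨ cong₂ ℚ._+_ (toℚ-* T (X′ K j x)) (toℚ-* W (V′ (suc K) j x)) ⟩
    toℚ T ℚ.* toℚ (X′ K j x) ℚ.+ toℚ W ℚ.* toℚ (V′ (suc K) j x) ∎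
    where
    open ≡-Reasoning
    K : ℕ
    K = N ℕ.+ k
    T W : ℤ
    T = + (θ ^ Δa K)
    W = + digit (suc K) j

  X∈spanG : ∀ {k} j → k < suc v′ → InSpan G (X′ (N ℕ.+ k) j)
  X∈spanG {k} j k<v = InSpan-resp {f = G} {y′ = X′ (N ℕ.+ k) j} G-at (InSpan-member G t)
    where
    t : Fin (suc v′ * d)
    t = Fin.combine (Fin.fromℕ< k<v) j
    G-at : ∀ x → G t x ≡ X′ (N ℕ.+ k) j x
    G-at x = trans (cong (λ (k′ , j′) → X′ (N ℕ.+ Fin.toℕ k′) j′ x) (FinP.remQuot-combine (Fin.fromℕ< k<v) j))
                   (cong (λ k′ → X′ (N ℕ.+ k′) j x) (FinP.toℕ-fromℕ< k<v))

  V∈spanG : ∀ {k} j → k < v′ → InSpan G (V′ (N ℕ.+ suc k) j)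
  V∈spanG {k} j k<v′ =
    InSpan-lincomb {g = G} {X′ (N ℕ.+ suc k) j} {X′ (N ℕ.+ k) j} {V′ (N ℕ.+ suc k) j}
      (X∈spanG {suc k} j (s≤s k<v′)) (X∈spanG {k} j (ℕP.m≤n⇒m≤1+n k<v′)) W⁻¹ (ℚ.- (W⁻¹ ℚ.* T)) (λ x → begin
        W⁻¹ ℚ.* toℚ (X′ (N ℕ.+ suc k) j x) ℚ.+ ℚ.- (W⁻¹ ℚ.* T) ℚ.* toℚ (X′ (N ℕ.+ k) j x)
          ≡⟨ cong (λ z → W⁻¹ ℚ.* z ℚ.+ ℚ.- (W⁻¹ ℚ.* T) ℚ.* toℚ (X′ (N ℕ.+ k) j x)) (X-step-ℚ k j x) ⟩
        W⁻¹ ℚ.* (T ℚ.* toℚ (X′ (N ℕ.+ k) j x) ℚ.+ W ℚ.* toℚ (V′ (N ℕ.+ suc k) j x))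
          ℚ.+ ℚ.- (W⁻¹ ℚ.* T) ℚ.* toℚ (X′ (N ℕ.+ k) j x)
          ≡⟨ eliminate-recurrence W⁻¹ W T (toℚ (X′ (N ℕ.+ k) j x)) (toℚ (V′ (N ℕ.+ suc k) j x))
                                  (ℚP.*-inverseˡ W) ⟩
        toℚ (V′ (N ℕ.+ suc k) j x) ∎)
    where
    open ≡-Reasoning
    T W W⁻¹ : ℚ
    T = toℚ (+ (θ ^ Δa (N ℕ.+ k)))
    W = toℚ (+ digit (N ℕ.+ suc k) j)
    instance
      W≢0 : ℚ.NonZero W
      W≢0 = ℚP.pos⇒nonZero W {{toℚ-positive (digit (N ℕ.+ suc k) j)}}
    W⁻¹ = ℚ.1/ W

  B⊆spanG : ∀ t → InSpan G (B t)
  B⊆spanG = ↑-elim lower upper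
    where
    lower : ∀ j → InSpan G (B (j ↑ˡ (v′ * d)))
    lower j = InSpan-resp {f = G} {y′ = B (j ↑ˡ (v′ * d))}
      (λ x → trans (cong (λ K → X′ K j x) (ℕP.+-identityʳ N)) (sym (B-↑ˡ j x))) (X∈spanG {0} j (s≤s z≤n))
    upper : ∀ t → InSpan G (B (d ↑ʳ t))
    upper t = InSpan-resp {f = G} {y′ = B (d ↑ʳ t)} (λ x → sym (B-↑ʳ t x))
      (V∈spanG (column t) (FinP.toℕ<n (Fin.quotient {v′} d t)))

  V∈spanB : ∀ {k} j → k < v′ → InSpan B (V′ (N ℕ.+ suc k) j)
  V∈spanB {k} j k<v′ = InSpan-resp {f = B} {y′ = V′ (N ℕ.+ suc k) j} B-at (InSpan-member B (d ↑ʳ t))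
    where
    t : Fin (v′ * d)
    t = Fin.combine (Fin.fromℕ< k<v′) j
    B-at : ∀ x → B (d ↑ʳ t) x ≡ V′ (N ℕ.+ suc k) j x
    B-at x = trans (B-↑ʳ t x)
      (trans (cong (λ (k′ , j′) → V′ (N ℕ.+ suc (Fin.toℕ k′)) j′ x) (FinP.remQuot-combine (Fin.fromℕ< k<v′) j))
             (cong (λ k′ → V′ (N ℕ.+ suc k′) j x) (FinP.toℕ-fromℕ< k<v′)))

  X∈spanB : ∀ k j → k < suc v′ → InSpan B (X′ (N ℕ.+ k) j)
  X∈spanB zero j _ = InSpan-resp {f = B} {y′ = X′ (N ℕ.+ 0) j}
    (λ x → trans (B-↑ˡ j x) (cong (λ K → X′ K j x) (sym (ℕP.+-identityʳ N)))) (InSpan-member B (j ↑ˡ (v′ * d)))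
  X∈spanB (suc k) j (s≤s k<v′) =
    InSpan-lincomb {g = B} {X′ (N ℕ.+ k) j} {V′ (N ℕ.+ suc k) j} {X′ (N ℕ.+ suc k) j}
      (X∈spanB k j (ℕP.m≤n⇒m≤1+n k<v′)) (V∈spanB j k<v′)
      (toℚ (+ (θ ^ Δa (N ℕ.+ k)))) (toℚ (+ digit (N ℕ.+ suc k) j)) (λ x → sym (X-step-ℚ k j x))

  G⊆spanB : ∀ t → InSpan B (G t)
  G⊆spanB t = X∈spanB (Fin.toℕ (Fin.quotient {suc v′} d t)) (Fin.remainder {suc v′} d t) (FinP.toℕ<n _)

  Vblock-coordˡ : ∀ t j → Vblock t (coordˡ j) ≡ + 0
  Vblock-coordˡ t j = V-coordˡ (N ℕ.+ level t) (column t) j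

  Vblock-lowerRow : ∀ t j → Vblock t (lowerRow j) ≡ + 0
  Vblock-lowerRow t j = V-off-pivot (N ℕ.+ level t) (column t) (λ eq →
    ℕP.0≢1+n (proj₁ (pivot-injective N {0} {level t} {j} {column t} (ℕ.>-nonZero⁻¹ q) (level<q t)
      (trans (cong (λ K → pivot K j) (ℕP.+-identityʳ N)) eq))))

  Vblock-upperRow : ∀ s t → s ≢ t → Vblock s (upperRow t) ≡ + 0
  Vblock-upperRow s t s≢t = V-off-pivot (N ℕ.+ level s) (column s) (λ eq →
    let (level≡ , column≡) = pivot-injective N {level t} {level s} {column t} {column s} (level<q t) (level<q s) eq
    in s≢t (sym (column-level-injective level≡ column≡)))

  linℚ-B : ∀ c x → linℚ c B x ≡ linℚ (lowerCoeffs c) Xblock x ℚ.+ linℚ (upperCoeffs c) Vblock x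
  linℚ-B c x = trans (linℚ-++ {d} {v′ * d} c B x)
    (cong₂ ℚ._+_ (linℚ-congʳ (B ∘ (_↑ˡ (v′ * d))) {Xblock} (lowerCoeffs c) x (λ j → B-↑ˡ j x))
                 (linℚ-congʳ (B ∘ (d ↑ʳ_)) {Vblock} (upperCoeffs c) x (λ t → B-↑ʳ t x)))

  linℚ-B-coordˡ : ∀ c j → linℚ c B (coordˡ j) ≡ lowerCoeffs c j ℚ.* toℚ (+ (θ ^ a N))
  linℚ-B-coordˡ c j = begin
    linℚ c B (coordˡ j)
      ≡⟨ linℚ-B c (coordˡ j) ⟩
    linℚ (lowerCoeffs c) Xblock (coordˡ j) ℚ.+ linℚ (upperCoeffs c) Vblock (coordˡ j)
      ≡⟨ cong₂ ℚ._+_ (linℚ-single Xblock (lowerCoeffs c) (coordˡ j) j (λ j′ j′≢j → X-coordˡ-≢ N (j′≢j ∘ sym)))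
                     (linℚ-zeroʳ Vblock (upperCoeffs c) (coordˡ j) (λ t → Vblock-coordˡ t j)) ⟩
    lowerCoeffs c j ℚ.* toℚ (Xblock j (coordˡ j)) ℚ.+ 0ℚ
      ≡⟨ ℚP.+-identityʳ (lowerCoeffs c j ℚ.* toℚ (Xblock j (coordˡ j))) ⟩
    lowerCoeffs c j ℚ.* toℚ (Xblock j (coordˡ j))
      ≡⟨ cong (λ z → lowerCoeffs c j ℚ.* toℚ z) (X-coordˡ-≡ N j) ⟩
    lowerCoeffs c j ℚ.* toℚ (+ (θ ^ a N)) ∎
    where open ≡-Reasoning

  linℚ-B-lowerRow : ∀ c j → linℚ c B (lowerRow j) ≡ linℚ (lowerCoeffs c) Xblock (lowerRow j)
  linℚ-B-lowerRow c j = begin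
    linℚ c B (lowerRow j)
      ≡⟨ linℚ-B c (lowerRow j) ⟩
    linℚ (lowerCoeffs c) Xblock (lowerRow j) ℚ.+ linℚ (upperCoeffs c) Vblock (lowerRow j)
      ≡⟨ cong (linℚ (lowerCoeffs c) Xblock (lowerRow j) ℚ.+_)
              (linℚ-zeroʳ Vblock (upperCoeffs c) (lowerRow j) (λ t → Vblock-lowerRow t j)) ⟩
    linℚ (lowerCoeffs c) Xblock (lowerRow j) ℚ.+ 0ℚ
      ≡⟨ ℚP.+-identityʳ (linℚ (lowerCoeffs c) Xblock (lowerRow j)) ⟩
    linℚ (lowerCoeffs c) Xblock (lowerRow j) ∎
    where open ≡-Reasoning

  linℚ-B-upperRow : ∀ c t → linℚ c B (upperRow t) ≡ linℚ (lowerCoeffs c) Xblock (upperRow t) ℚ.+ upperCoeffs c t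
  linℚ-B-upperRow c t = trans (linℚ-B c (upperRow t)) (cong (linℚ (lowerCoeffs c) Xblock (upperRow t) ℚ.+_) (begin
    linℚ (upperCoeffs c) Vblock (upperRow t)
      ≡⟨ linℚ-single Vblock (upperCoeffs c) (upperRow t) t (λ s s≢t → Vblock-upperRow s t s≢t) ⟩
    upperCoeffs c t ℚ.* toℚ (Vblock t (upperRow t))
      ≡⟨ cong (λ z → upperCoeffs c t ℚ.* toℚ z) (V-pivot (N ℕ.+ level t) (column t)) ⟩
    upperCoeffs c t ℚ.* 1ℚ
      ≡⟨ ℚP.*-identityʳ (upperCoeffs c t) ⟩
    upperCoeffs c t ∎))
    where open ≡-Reasoning

  M : ℕ
  M = θ ^ a N

  instance
    M≢0 : NonZero M
    M≢0 = ℕP.m^n≢0 θ (a N) {{prime⇒nonZero θ-prime}}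

  B-independent : LinIndep B
  B-independent c Bc≡0 = ↑-elim lower≡0 upper≡0
    where
    lower≡0 : ∀ j → lowerCoeffs c j ≡ 0ℚ
    lower≡0 j = toℚ-*-cancelʳ M (begin
      lowerCoeffs c j ℚ.* toℚ (+ M)   ≡⟨ linℚ-B-coordˡ c j ⟨
      linℚ c B (coordˡ j)             ≡⟨ Bc≡0 (coordˡ j) ⟩
      0ℚ                              ≡⟨ ℚP.*-zeroˡ (toℚ (+ M)) ⟨
      0ℚ ℚ.* toℚ (+ M)                ∎)
      where open ≡-Reasoning
    upper≡0 : ∀ t → upperCoeffs c t ≡ 0ℚ
    upper≡0 t = begin
      upperCoeffs c t
        ≡⟨ ℚP.+-identityˡ (upperCoeffs c t) ⟨
      0ℚ ℚ.+ upperCoeffs c t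
        ≡⟨ cong (ℚ._+ upperCoeffs c t) (linℚ-zeroˡ Xblock (upperRow t) lower≡0) ⟨
      linℚ (lowerCoeffs c) Xblock (upperRow t) ℚ.+ upperCoeffs c t
        ≡⟨ linℚ-B-upperRow c t ⟨
      linℚ c B (upperRow t)
        ≡⟨ Bc≡0 (upperRow t) ⟩
      0ℚ ∎
      where open ≡-Reasoning

  diagonal-not-divisible : ∀ j → ¬ (+ θ ∣ Xblock j (lowerRow j))
  diagonal-not-divisible j θ∣X rewrite X-coordʳ N j (pivot N j) =
    θ∤digit θ≥5 N j (θ∣θᵃσ⇒θ∣u (pivot N j) j N (ℤ∣.∣⇒∣ᵤ θ∣X))

  off-diagonal-divisible : ∀ j j′ → j′ ≢ j → + θ ∣ Xblock j′ (lowerRow j)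
  off-diagonal-divisible j j′ j′≢j rewrite X-coordʳ N j′ (pivot N j) =
    ℤ∣.∣ᵤ⇒∣ (θ∣θᵃσ (pivot N j) j′ N (u-off-pivot (j′≢j ∘ sym ∘ pivot-injectiveʳ N)))

  module Integrality (y : ZVec (suc q * d)) (c : Fin (suc v′ * d) → ℚ)
                     (Bc≡y : ∀ x → linℚ c B x ≡ toℚ (y x)) where

    yˡ : Fin d → ℤ
    yˡ j = y (coordˡ j)

    lower*M≡yˡ : ∀ j → lowerCoeffs c j ℚ.* toℚ (+ M) ≡ toℚ (yˡ j)
    lower*M≡yˡ j = trans (sym (linℚ-B-coordˡ c j)) (Bc≡y (coordˡ j))

    Xyˡ≡y*M : ∀ j → linℤ yˡ Xblock (lowerRow j) ≡ y (lowerRow j) ℤ.* + M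
    Xyˡ≡y*M j = toℚ-injective (begin
      toℚ (linℤ yˡ Xblock (lowerRow j))
        ≡⟨ toℚ-linℤ Xblock yˡ (lowerRow j) ⟩
      linℚ (toℚ ∘ yˡ) Xblock (lowerRow j)
        ≡⟨ linℚ-congˡ Xblock (lowerRow j)
             (λ j′ → trans (sym (lower*M≡yˡ j′)) (ℚP.*-comm (lowerCoeffs c j′) (toℚ (+ M)))) ⟩
      linℚ (λ j′ → toℚ (+ M) ℚ.* lowerCoeffs c j′) Xblock (lowerRow j)
        ≡⟨ linℚ-*ˡ Xblock (toℚ (+ M)) (lowerCoeffs c) (lowerRow j) ⟨
      toℚ (+ M) ℚ.* linℚ (lowerCoeffs c) Xblock (lowerRow j)
        ≡⟨ cong (toℚ (+ M) ℚ.*_) (trans (sym (linℚ-B-lowerRow c j)) (Bc≡y (lowerRow j))) ⟩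
      toℚ (+ M) ℚ.* toℚ (y (lowerRow j))
        ≡⟨ ℚP.*-comm (toℚ (+ M)) (toℚ (y (lowerRow j))) ⟩
      toℚ (y (lowerRow j)) ℚ.* toℚ (+ M)
        ≡⟨ toℚ-* (y (lowerRow j)) (+ M) ⟨
      toℚ (y (lowerRow j) ℤ.* + M) ∎)
      where open ≡-Reasoning

    M∣yˡ : ∀ j → + M ∣ yˡ j
    M∣yˡ = p^E∣Am⇒p^E∣m θ-prime (λ j j′ → Xblock j′ (lowerRow j)) diagonal-not-divisible off-diagonal-divisible
             (a N) yˡ (λ j → ℤ∣.divides (y (lowerRow j)) (Xyˡ≡y*M j))

    r : Fin d → ℤ
    r j = ℤ∣._∣_.quotient (M∣yˡ j)

    lower≡r : ∀ j → lowerCoeffs c j ≡ toℚ (r j)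
    lower≡r j = toℚ-*-cancelʳ M (begin
      lowerCoeffs c j ℚ.* toℚ (+ M)   ≡⟨ lower*M≡yˡ j ⟩
      toℚ (yˡ j)                      ≡⟨ cong toℚ (ℤ∣._∣_.equality (M∣yˡ j)) ⟩
      toℚ (r j ℤ.* + M)               ≡⟨ toℚ-* (r j) (+ M) ⟩
      toℚ (r j) ℚ.* toℚ (+ M)         ∎)
      where open ≡-Reasoning

    lower-integral : ∀ j → Σ ℤ λ z → lowerCoeffs c j ≡ toℚ z
    lower-integral j = r j , lower≡r j

    upper-integral : ∀ t → Σ ℤ λ z → upperCoeffs c t ≡ toℚ z
    upper-integral t = y (upperRow t) ℤ.- linℤ r Xblock (upperRow t) ,
      toℚ-difference (y (upperRow t)) (linℤ r Xblock (upperRow t)) (begin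
        toℚ (linℤ r Xblock (upperRow t)) ℚ.+ upperCoeffs c t
          ≡⟨ cong (ℚ._+ upperCoeffs c t)
               (trans (toℚ-linℤ Xblock r (upperRow t)) (linℚ-congˡ Xblock (upperRow t) (sym ∘ lower≡r))) ⟩
        linℚ (lowerCoeffs c) Xblock (upperRow t) ℚ.+ upperCoeffs c t
          ≡⟨ linℚ-B-upperRow c t ⟨
        linℚ c B (upperRow t)
          ≡⟨ Bc≡y (upperRow t) ⟩
        toℚ (y (upperRow t)) ∎)
      where open ≡-Reasoning

  B-integral : ∀ y → InSpan B y → InZSpan B y
  B-integral y (c , Bc≡y) = InSpan⇒InZSpan {f = B} {y} (c , Bc≡y) (↑-elim lower-integral upper-integral)
    where open Integrality y c Bc≡y

lemma3p1 : (d q : ℕ) .{{_ : NonZero d}} .{{_ : NonZero q}}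
           (θ : ℕ) → Prime θ → 5 ≤ θ →
           (a : ℕ → ℕ) → (∀ k → a k < a (suc k)) →
           (u : Fin (q * d) → Fin d → ℕ → ℕ) → DigitHyp q d u →
           (N v : ℕ) → 1 ≤ N → 1 ≤ v → v ≤ q →
           HasDim (Bgen q d θ a u N v) (d * v)
           × IsZBasisOfSpanLattice (Bbasis q d θ a u N v) (Bgen q d θ a u N v)
lemma3p1 d q θ θ-prime θ≥5 a a-increasing u digits N zero _ () _
lemma3p1 d q θ θ-prime θ≥5 a a-increasing u digits N (suc v′) _ _ v≤q =
    subst (HasDim G) (ℕP.*-comm (suc v′) d) (B , B⊆spanG , B-independent , InSpan-trans G B B⊆spanG)
  , B⊆spanG , LinIndep⇒ZLinIndep B-independent , λ y → B-integral y ∘ InSpan-trans B G G⊆spanB y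
  where open Block d q θ θ-prime θ≥5 a a-increasing u digits N v′ v≤q
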